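{- For every positive integer $n$, there is a complete game of the Fibonacci Quilt Game on $n$ in which none of the moves of Rules (2a), (3c), (3d), (3e), (3f), (3g), (4b), (4c), (4d), (4e) is used (i.e. every move replaces two terms by a single term).
   Context: Let $(q_i)_{i\ge1}$ be the Fibonacci Quilt sequence: $q_1=1,q_2=2,q_3=3,q_4=4$ and $q_i=q_{i-3}+q_{i-2}$ for $i\ge5$. The Fibonacci Quilt Game on $n$: a position is a finite multiset of terms $q_i$ (recorded by their indices); the initial position is $n$ copies of $q_1$. A move replaces two elements of the current multiset (with multiplicity) by one or two elements according to one of the following rules: (1a) $q_1,q_2\to q_3$; (1b) for $i\ge2$, $q_i,q_{i+1}\to q_{i+3}$; (2a) $q_1,q_5\to q_2,q_4$, allowed only if no other move is possible in the current position; (2b) for $i\ge2$, $q_i,q_{i+4}\to q_{i+5}$; (3a) $q_1,q_1\to q_2$; (3b) $q_2,q_2\to q_4$; (3c) $q_3,q_3\to q_2,q_4$; (3d) $q_4,q_4\to q_1,q_6$ or $q_4,q_4\to q_3,q_5$ (player's choice); (3e) $q_5,q_5\to q_1,q_7$; (3f) $q_6,q_6\to q_2,q_8$ or $q_6,q_6\to q_3,q_7$ (player's choice); (3g) for $i\ge7$, $q_i,q_i\to q_{i-5},q_{i+2}$; (4a) for $i=1,2$, $q_i,q_{i+3}\to q_{i+4}$; (4b) $q_3,q_6\to q_1,q_7$; (4c) for $i=4,5$, $q_i,q_{i+3}\to q_1,q_{i+4}$; (4d) $q_6,q_9\to q_2,q_{10}$; (4e) for $i\ge7$, $q_i,q_{i+3}\to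 q_{i-5},q_{i+4}$; (5) $q_1,q_3\to q_4$. A complete game is a sequence of legal moves from the initial position to a position in which no move is possible. -}

module Defs where

open import Data.Nat using (ℕ; _+_; _∸_; _≤_)
open import Data.List using (List; []; _∷_; _++_; replicate)
open import Data.List.Relation.Binary.Permutation.Propositional using (_↭_)
open import Data.Product using (Σ; ∃; ∃-syntax; _×_)
open import Relation.Nullary using (¬_)
open import Relation.Binary.PropositionalEquality using (_≡_; _≢_)
open import Relation.Binary.Construct.Closure.ReflexiveTransitive using (Star)

-- A position is a finite multiset of Fibonacci Quilt terms q_i, recorded by
-- their indices i ≥ 1, represented as a list taken up to permutation.
Position : Set
Position = List ℕ

initial : ℕ → Position
initial n = replicate n 1

-- Names of the rules (3d and 3f have two player-chosen variants).
data RuleName : Set where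
  r1a r1b r2a r2b r3a r3b r3c r3d r3e r3f r3g r4a r4b r4c r4d r4e r5 : RuleName

-- Rule nm a b out : rule nm replaces the pair q_a, q_b by the terms with indices out.
data Rule : RuleName → ℕ → ℕ → List ℕ → Set where
  rule1a : Rule r1a 1 2 (3 ∷ [])
  rule1b : ∀ {i} → 2 ≤ i → Rule r1b i (i + 1) ((i + 3) ∷ [])
  rule2a : Rule r2a 1 5 (2 ∷ 4 ∷ [])
  rule2b : ∀ {i} → 2 ≤ i → Rule r2b i (i + 4) ((i + 5) ∷ [])
  rule3a : Rule r3a 1 1 (2 ∷ [])
  rule3b : Rule r3b 2 2 (4 ∷ [])
  rule3c : Rule r3c 3 3 (2 ∷ 4 ∷ [])
  rule3d₁ : Rule r3d 4 4 (1 ∷ 6 ∷ [])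
  rule3d₂ : Rule r3d 4 4 (3 ∷ 5 ∷ [])
  rule3e : Rule r3e 5 5 (1 ∷ 7 ∷ [])
  rule3f₁ : Rule r3f 6 6 (2 ∷ 8 ∷ [])
  rule3f₂ : Rule r3f 6 6 (3 ∷ 7 ∷ [])
  rule3g : ∀ {i} → 7 ≤ i → Rule r3g i i ((i ∸ 5) ∷ (i + 2) ∷ [])
  rule4a₁ : Rule r4a 1 4 (5 ∷ [])
  rule4a₂ : Rule r4a 2 5 (6 ∷ [])
  rule4b : Rule r4b 3 6 (1 ∷ 7 ∷ [])
  rule4c₁ : Rule r4c 4 7 (1 ∷ 8 ∷ [])
  rule4c₂ : Rule r4c 5 8 (1 ∷ 9 ∷ [])
  rule4d : Rule r4d 6 9 (2 ∷ 10 ∷ [])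
  rule4e : ∀ {i} → 7 ≤ i → Rule r4e i (i + 3) ((i ∸ 5) ∷ (i + 4) ∷ [])
  rule5 : Rule r5 1 3 (4 ∷ [])

-- Applying rule nm to two elements (with multiplicity) of position p gives p'.
-- (Which of the two chosen elements is "first" is immaterial since p is a multiset.)
RStep : RuleName → Position → Position → Set
RStep nm p p' =
  Σ ℕ λ a → Σ ℕ λ b → Σ (List ℕ) λ out → Σ Position λ rest →
    (p ↭ (a ∷ b ∷ rest)) × Rule nm a b out × (p' ↭ (out ++ rest))

OtherMovePossible : Position → Set
OtherMovePossible p = ∃[ nm ] ∃[ p' ] (nm ≢ r2a × RStep nm p p')

Legal : RuleName → Position → Position → Set
Legal nm p p' = RStep nm p p' × (nm ≡ r2a → ¬ OtherMovePossible p)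

Terminal : Position → Set
Terminal p = ¬ (∃[ nm ] ∃[ p' ] Legal nm p p')

data Permitted : RuleName → Set where
  p1a : Permitted r1a
  p1b : Permitted r1b
  p2b : Permitted r2b
  p3a : Permitted r3a
  p3b : Permitted r3b
  p4a : Permitted r4a
  p5  : Permitted r5

PermittedMove : Position → Position → Set
PermittedMove p p' = ∃[ nm ] (Permitted nm × Legal nm p p')

CompleteGameWithoutExcluded : ℕ → Set
CompleteGameWithoutExcluded n =
  ∃[ final ] (Star PermittedMove (initial n) final × Terminal final)

module Submission where

-- Call two indices a, b *clashing* when some rule of the
-- game takes the pair q_a, q_b as input; this happens only when they are equal,
-- differ by 1, 3 or 4, or are {1, 3}.  A position whose indices are pairwise
-- non-clashing ("separated") admits no move at all, so it is terminal.
--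
-- (1) Every single term q_i can be built from q_i copies of q_1 using only the
--     merging rules 1a, 1b, 3a, 4a, 5 (follow the recurrence q_i = q_{i-3} +
--     q_{i-2}); building the terms of a list side by side reaches the list
--     itself from  value L  copies of q_1, where value L is the sum of its terms.
-- (2) Every r < q_{k+1} is the value of a separated list of indices in 1..k:
--     greedily take q_k when r ≥ q_k; for k ≥ 6 the remainder is below
--     q_{k+1} - q_k = q_{k-4}, so it is represented by indices ≤ k-5, all of which
--     are far from k.  Small k are handled directly (6 = q_4 + q_2).
-- The theorem follows by representing n (note n < q_{n+1}) and assembling the
-- representation from the initial position: the final position is separated.

open import Defs
open import Data.Nat using (ℕ; _≤_; zero; suc; _+_; _∸_; _<_; z≤n; s≤s; _<?_; _≟_)
open import Data.Nat.Properties
open import Data.List using ([]; _∷_; _++_)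
open import Data.List.Properties using (++-assoc; ++-identityʳ)
open import Data.List.Relation.Unary.All as All using (All; []; _∷_)
open import Data.List.Relation.Unary.AllPairs using (AllPairs; []; _∷_)
open import Data.List.Relation.Binary.Permutation.Propositional
  using (_↭_; ↭-refl; ↭-reflexive; ↭-trans; ↭⇒↭ₛ)
open import Data.List.Relation.Binary.Permutation.Propositional.Properties
  using (++⁺ʳ; ++-comm)
import Data.List.Relation.Binary.Permutation.Setoid.Properties as SetoidPermutation
open import Data.Product using (_×_; _,_; proj₁; proj₂)
open import Data.Sum using (_⊎_; inj₁; inj₂; swap)
open import Data.Empty using (⊥-elim)
open import Relation.Nullary using (¬_; yes; no)
open import Relation.Binary.PropositionalEquality
  using (_≡_; _≢_; refl; sym; cong; subst; subst₂; resp₂; setoid; module ≡-Reasoning)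
open import Relation.Binary.Construct.Closure.ReflexiveTransitive using (Star; ε; _◅_; _◅◅_; gmap)

-- The Fibonacci Quilt sequence, q 0 = 0 being a harmless convention.
q : ℕ → ℕ
q 0 = 0
q 1 = 1
q 2 = 2
q 3 = 3
q 4 = 4
q (suc (suc (suc (suc (suc n))))) = q (suc (suc n)) + q (suc (suc (suc n)))

index≤term : ∀ n → n ≤ q n
index≤term 0 = z≤n
index≤term 1 = s≤s z≤n
index≤term 2 = s≤s (s≤s z≤n)
index≤term 3 = s≤s (s≤s (s≤s z≤n))
index≤term 4 = s≤s (s≤s (s≤s (s≤s z≤n)))
index≤term (suc (suc (suc (suc (suc n))))) =
  ≤-trans (+-monoˡ-≤ (3 + n) (m≤m+n 2 n))
          (+-mono-≤ (index≤term (suc (suc n))) (index≤term (suc (suc (suc n)))))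

q-gap : ∀ j → q (7 + j) ≡ q (6 + j) + q (2 + j)
q-gap j = begin
  c + (a + b)   ≡⟨ cong (c +_) (+-comm a b) ⟩
  c + (b + a)   ≡⟨ sym (+-assoc c b a) ⟩
  (c + b) + a   ≡⟨ cong (_+ a) (+-comm c b) ⟩
  (b + c) + a   ∎
  where
  open ≡-Reasoning
  a = q (2 + j)
  b = q (3 + j)
  c = q (4 + j)

value : Position → ℕ
value []      = 0
value (i ∷ p) = q i + value p

-- Near a b: the (ordered) index pair a ≤ b is the input of some rule.
data Near : ℕ → ℕ → Set where
  same      : ∀ {a} → Near a a
  gap1      : ∀ {a} → Near a (1 + a)
  gap3      : ∀ {a} → Near a (3 + a)
  gap4      : ∀ {a} → Near a (4 + a)
  one-three : Near 1 3

rule⇒near : ∀ {nm a b out} → Rule nm a b out → Near a b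
rule⇒near rule1a = gap1
rule⇒near (rule1b {i} _) = subst (Near i) (+-comm 1 i) gap1
rule⇒near rule2a = gap4
rule⇒near (rule2b {i} _) = subst (Near i) (+-comm 4 i) gap4
rule⇒near rule3a = same
rule⇒near rule3b = same
rule⇒near rule3c = same
rule⇒near rule3d₁ = same
rule⇒near rule3d₂ = same
rule⇒near rule3e = same
rule⇒near rule3f₁ = same
rule⇒near rule3f₂ = same
rule⇒near (rule3g _) = same
rule⇒near rule4a₁ = gap3
rule⇒near rule4a₂ = gap3
rule⇒near rule4b = gap3
rule⇒near rule4c₁ = gap3
rule⇒near rule4c₂ = gap3
rule⇒near rule4d = gap3
rule⇒near (rule4e {i} _) = subst (Near i) (+-comm 3 i) gap3
rule⇒near rule5 = one-three

near⇒close : ∀ {a b} → Near a b → a ≤ b × b ≤ 4 + a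
near⇒close {a} same      = ≤-refl , m≤n+m a 4
near⇒close {a} gap1      = n≤1+n a , +-monoˡ-≤ a (s≤s z≤n)
near⇒close {a} gap3      = m≤n+m a 3 , +-monoˡ-≤ a (s≤s (s≤s (s≤s z≤n)))
near⇒close {a} gap4      = m≤n+m a 4 , ≤-refl
near⇒close     one-three = s≤s z≤n , s≤s (s≤s (s≤s z≤n))

Apart : ℕ → ℕ → Set
Apart a b = ¬ (Near a b ⊎ Near b a)

apart-sym : ∀ {a b} → Apart a b → Apart b a
apart-sym apart near = apart (swap near)

far⇒apart : ∀ {a b} → 5 + b ≤ a → Apart a b
far⇒apart far (inj₁ near) = <⇒≱ (≤-trans (m≤n+m (suc _) 4) far) (proj₁ (near⇒close near))
far⇒apart far (inj₂ near) = <⇒≱ far (proj₂ (near⇒close near))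

Separated : Position → Set
Separated = AllPairs Apart

separated-↭ : ∀ {p p'} → p ↭ p' → Separated p → Separated p'
separated-↭ π = SetoidPermutation.AllPairs-resp-↭ (setoid ℕ) apart-sym (resp₂ Apart) (↭⇒↭ₛ π)

separated⇒terminal : ∀ {p} → Separated p → Terminal p
separated⇒terminal sep (_ , _ , (_ , _ , _ , _ , π , rule , _) , _)
  with separated-↭ π sep
... | (apart ∷ _) ∷ _ = apart (inj₁ (rule⇒near rule))

-- Moves by permitted rules are never moves by rule 2a, so they are legal.
permitted≢r2a : ∀ {nm} → Permitted nm → nm ≢ r2a
permitted≢r2a p1a ()
permitted≢r2a p1b ()
permitted≢r2a p2b ()
permitted≢r2a p3a ()
permitted≢r2a p3b ()
permitted≢r2a p4a ()
permitted≢r2a p5  ()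

permittedMove : ∀ {nm p p'} → Permitted nm → RStep nm p p' → PermittedMove p p'
permittedMove {nm} perm step = nm , perm , step , λ r2a → ⊥-elim (permitted≢r2a perm r2a)

merge : ∀ {nm a b out} → Permitted nm → Rule nm a b out → PermittedMove (a ∷ b ∷ []) out
merge {a = a} {b} {out} perm rule =
  permittedMove perm (a , b , out , [] , ↭-refl , rule , ↭-reflexive (sym (++-identityʳ out)))

move-framedʳ : ∀ c {p p'} → PermittedMove p p' → PermittedMove (p ++ c) (p' ++ c)
move-framedʳ c (_ , perm , (a , b , out , rest , π , rule , π') , _) =
  permittedMove perm (a , b , out , rest ++ c , ++⁺ʳ c π , rule ,
                      ↭-trans (++⁺ʳ c π') (↭-reflexive (++-assoc out rest c)))

move-↭ : ∀ {p₀ p₀' p p'} → p ↭ p₀ → p' ↭ p₀' → PermittedMove p₀ p₀' → PermittedMove p p'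
move-↭ σ σ' (_ , perm , (a , b , out , rest , π , rule , π') , _) =
  permittedMove perm (a , b , out , rest , ↭-trans σ π , rule , ↭-trans σ' π')

move-framedˡ : ∀ c {p p'} → PermittedMove p p' → PermittedMove (c ++ p) (c ++ p')
move-framedˡ c {p} {p'} m = move-↭ (++-comm c p) (++-comm c p') (move-framedʳ c m)

replicate-+ : ∀ a b → initial (a + b) ≡ initial a ++ initial b
replicate-+ zero    b = refl
replicate-+ (suc a) b = cong (1 ∷_) (replicate-+ a b)

parallel : ∀ {a b L₁ L₂} → Star PermittedMove (initial a) L₁ → Star PermittedMove (initial b) L₂ →
           Star PermittedMove (initial (a + b)) (L₁ ++ L₂)
parallel {a} {b} {L₁} g₁ g₂ =
  subst (λ p → Star PermittedMove p _) (sym (replicate-+ a b))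
        (gmap (_++ initial b) (move-framedʳ (initial b)) g₁ ◅◅ gmap (L₁ ++_) (move-framedˡ L₁) g₂)

buildTerm : ∀ k → Star PermittedMove (initial (q (suc k))) (suc k ∷ [])
buildTerm 0 = ε
buildTerm 1 = merge p3a rule3a ◅ ε
buildTerm 2 = parallel (buildTerm 0) (buildTerm 1) ◅◅ (merge p1a rule1a ◅ ε)
buildTerm 3 = parallel (buildTerm 0) (buildTerm 2) ◅◅ (merge p5 rule5 ◅ ε)
buildTerm 4 = parallel (buildTerm 0) (buildTerm 3) ◅◅ (merge p4a rule4a₁ ◅ ε)
buildTerm (suc (suc (suc (suc (suc j))))) =
  parallel (buildTerm (suc (suc j))) (buildTerm (suc (suc (suc j)))) ◅◅ (merge p1b consecutive ◅ ε)
  where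
  consecutive : Rule r1b (3 + j) (4 + j) ((6 + j) ∷ [])
  consecutive = subst₂ (λ b c → Rule r1b (3 + j) b (c ∷ [])) (+-comm (3 + j) 1) (+-comm (3 + j) 3)
                       (rule1b (s≤s (s≤s z≤n)))

assemble : ∀ L → All (1 ≤_) L → Star PermittedMove (initial (value L)) L
assemble []      []                = ε
assemble (suc k ∷ L) (s≤s z≤n ∷ pos) = parallel (buildTerm k) (assemble L pos)

record Representation (k r : ℕ) : Set where
  constructor representation
  field
    terms     : Position
    sums      : value terms ≡ r
    separated : Separated terms
    bounded   : All (λ i → 1 ≤ i × i ≤ k) terms

empty : ∀ {k} → Representation k 0
empty = representation [] refl [] []

single : ∀ {k} i → 1 ≤ i → i ≤ k → Representation k (q i)
single i pos bound = representation (i ∷ []) (+-identityʳ (q i)) ([] ∷ []) ((pos , bound) ∷ [])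

widen : ∀ {k k' r} → k ≤ k' → Representation k r → Representation k' r
widen k≤k' (representation L sums sep bnd) =
  representation L sums sep (All.map (λ (pos , i≤k) → pos , ≤-trans i≤k k≤k') bnd)

addLarge : ∀ {k s} m → 5 + k ≤ m → Representation k s → Representation m (q m + s)
addLarge {k} m far (representation L sums sep bnd) =
  representation (m ∷ L) (cong (q m +_) sums)
    (All.map (λ (_ , i≤k) → far⇒apart (≤-trans (+-monoʳ-≤ 5 i≤k) far)) bnd ∷ sep)
    ((≤-trans (s≤s z≤n) far , ≤-refl) ∷
     All.map (λ (pos , i≤k) → pos , ≤-trans i≤k (≤-trans (m≤n+m k 5) far)) bnd)

represent : ∀ k r → r < q (suc k) → Representation k r

representTop : ∀ k r → q (suc k) ≤ r → r < q (2 + k) → Representation (suc k) r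

represent k 0 _ = empty
represent 0 (suc r) (s≤s ())
represent (suc k) (suc r) lt with suc r <? q (suc k)
... | yes below = widen (n≤1+n k) (represent k (suc r) below)
... | no  above = representTop k (suc r) (≮⇒≥ above) lt

representTop 0 r ge lt = subst (Representation 1) (≤-antisym ge (≤-pred lt)) (single 1 ≤-refl ≤-refl)
representTop 1 r ge lt = subst (Representation 2) (≤-antisym ge (≤-pred lt)) (single 2 (s≤s z≤n) ≤-refl)
representTop 2 r ge lt = subst (Representation 3) (≤-antisym ge (≤-pred lt)) (single 3 (s≤s z≤n) ≤-refl)
representTop 3 r ge lt = subst (Representation 4) (≤-antisym ge (≤-pred lt)) (single 4 (s≤s z≤n) ≤-refl)
representTop 4 r ge lt with r ≟ 5
... | yes r≡5 = subst (Representation 5) (sym r≡5) (single 5 (s≤s z≤n) ≤-refl)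
... | no  r≢5 = subst (Representation 5) (≤-antisym (≤∧≢⇒< ge (λ e → r≢5 (sym e))) (≤-pred lt)) six
  where
  -- 6 = q_4 + q_2, avoiding the clashing 6 = q_5 + q_1.
  six : Representation 5 6
  six = representation (4 ∷ 2 ∷ []) refl
          ((apart-4-2 ∷ []) ∷ [] ∷ [])
          ((s≤s z≤n , s≤s (s≤s (s≤s (s≤s z≤n)))) ∷ (s≤s z≤n , s≤s (s≤s z≤n)) ∷ [])
    where
    apart-4-2 : Apart 4 2
    apart-4-2 (inj₁ ())
    apart-4-2 (inj₂ ())
representTop (suc (suc (suc (suc (suc j))))) r ge lt =
  subst (Representation (6 + j)) (m+[n∸m]≡n ge) (addLarge (6 + j) ≤-refl (represent (suc j) s remainder<))
  where
  s = r ∸ q (6 + j)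
  remainder< : s < q (2 + j)
  remainder< = subst (s <_) (begin
    q (7 + j) ∸ q (6 + j)               ≡⟨ cong (_∸ q (6 + j)) (q-gap j) ⟩
    q (6 + j) + q (2 + j) ∸ q (6 + j)   ≡⟨ m+n∸m≡n (q (6 + j)) (q (2 + j)) ⟩
    q (2 + j)                           ∎) (∸-monoˡ-< lt ge)
    where open ≡-Reasoning

corollary2p6 : (n : ℕ) → 1 ≤ n → CompleteGameWithoutExcluded n
corollary2p6 n _ = terms , game , separated⇒terminal separated
  where
  open Representation (represent n n (index≤term (suc n)))
  game : Star PermittedMove (initial n) terms
  game = subst (λ m → Star PermittedMove (initial m) terms) sums
               (assemble terms (All.map proj₁ bounded))
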